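{- Let $\underline P_1,\underline P_2$ be patterns of lengths $k_1,k_2$, let $Q_1\in\mathbb{Z}[y_1,\dots,y_{k_1},m]$, $Q_2\in\mathbb{Z}[y_1,\dots,y_{k_2},m]$, and let $\lambda\in\Pi(n)$. There is a bijection between $$\{(s_1,s_2): s_1\text{ an occurrence of }\underline P_1\text{ in }\lambda,\ s_2\text{ an occurrence of }\underline P_2\text{ in }\lambda\}$$ and $$\{(\underline P_3,s_3,(m_1,m_2)): \underline P_3\text{ a pattern},\ (m_1,m_2)\text{ a merge of }\underline P_1,\underline P_2\text{ onto }\underline P_3,\ s_3\text{ an occurrence of }\underline P_3\text{ in }\lambda\}.$$ Moreover, if $(s_1,s_2)$ corresponds to $(\underline P_3,s_3,(m_1,m_2))$ with $s_3=(z_1,\dots,z_{k_3})$, then $$Q_1(z_{m_1(1)},\dots,z_{m_1(k_1)},n)\,Q_2(z_{m_2(1)},\dots,z_{m_2(k_2)},n)=Q_1(s_1)Q_2(s_2),$$ where $Q_a(s_a)$ means $Q_a$ evaluated at the entries of $s_a$ and $m=n$.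
   Context: $\Pi(n)$ is the set of set partitions of $[n]=\{1,\dots,n\}$. For $\lambda\in\Pi(n)$ write $i\sim_\lambda j$ if $i,j$ are in the same block; $\mathbf{First}(\lambda)$ (resp. $\mathbf{Last}(\lambda)$) is the set of elements smallest (resp. largest) in their block; $\mathbf{Arc}(\lambda)$ is the set of pairs $(i,j)$, $i<j$, $i\sim_\lambda j$, with $j$ the smallest element of the block of $i$ exceeding $i$. A pattern of length $k$ is $\underline P=(P,\mathbf F(\underline P),\mathbf L(\underline P),\mathbf A(\underline P),\mathbf C(\underline P))$ with $P$ a set partition of $[k]$, $\mathbf F,\mathbf L\subseteq[k]$, $\mathbf A,\mathbf C\subseteq[k]\times[k]$. An occurrence of $\underline P$ in $\lambda$ is $s=(x_1,\dots,x_k)\in[n]^k$ with: $x_1<\dots<x_k$; $x_i\sim_\lambda x_j$ iff $i\sim_P j$; $x_i\in\mathbf{First}(\lambda)$ if $i\in\mathbf F$; $x_i\in\mathbf{Last}(\lambda)$ if $i\in\mathbf L$; $(x_i,x_j)\in\mathbf{Arc}(\lambda)$ if $(i,j)\in\mathbf A$; $|x_i-x_j|=1$ if $(i,j)\in\mathbf C$. Given patterns $\underline P_1,\underline P_2,\underline P_3$ of lengths $k_1,k_2,k_3$, a merge of $\underline P_1,\underline P_2$ onto $\underline P_3$ is a pair of strictly increasing maps $m_1:[k_1]\to[k_3]$, $m_2:[k_2]\to[k_3]$ such that: (1) $m_1([k_1])\cup m_2([k_2])=[k_3]$; (2) for $a=1,2$, $m_a(i)\sim_{P_3}m_a(j)$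 iff $i\sim_{P_a}j$; (3) $i\in\mathbf F(\underline P_3)$ iff $i=m_a(j)$ for some $a$ and some $j\in\mathbf F(\underline P_a)$; (4) the same for $\mathbf L$; (5) $(i,i')\in\mathbf A(\underline P_3)$ iff $(i,i')=(m_a(j),m_a(j'))$ for some $a$ and $(j,j')\in\mathbf A(\underline P_a)$; (6) the same for $\mathbf C$. -}

module Defs where

open import Data.Bool using (Bool; true; false; _∧_; _∨_; not; T; if_then_else_)
open import Data.Nat using (ℕ; zero; suc; _≡ᵇ_; _<ᵇ_)
open import Data.Fin using (Fin; toℕ)
open import Data.Vec using (Vec; lookup)
open import Data.List using (List)
open import Data.Bool.ListAction using (all; any)
open import Data.List.Base using (allFin)
open import Data.Product using (Σ; _×_; _,_; proj₁; proj₂)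
open import Data.Integer using (ℤ; +_) renaming (_+_ to _+ℤ_; _*_ to _*ℤ_)

_⇒ᵇ_ : Bool → Bool → Bool
a ⇒ᵇ b = not a ∨ b

_⇔ᵇ_ : Bool → Bool → Bool
true  ⇔ᵇ b = b
false ⇔ᵇ b = not b

∀ᵇ : (k : ℕ) → (Fin k → Bool) → Bool
∀ᵇ k p = all p (allFin k)

∃ᵇ : (k : ℕ) → (Fin k → Bool) → Bool
∃ᵇ k p = any p (allFin k)

-- comparisons of elements of Fin k (Fin k = {0,...,k-1} encodes [k] = {1,...,k},
-- i ↦ i+1, an order-preserving relabelling)
_≡F_ : ∀ {k l} → Fin k → Fin l → Bool
i ≡F j = toℕ i ≡ᵇ toℕ j

_<F_ : ∀ {k l} → Fin k → Fin l → Bool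
i <F j = toℕ i <ᵇ toℕ j

adjacent : ∀ {n} → Fin n → Fin n → Bool
adjacent x y = (suc (toℕ x) ≡ᵇ toℕ y) ∨ (suc (toℕ y) ≡ᵇ toℕ x)

Rel : ℕ → Set
Rel k = Vec (Vec Bool k) k

_∋_∼_ : ∀ {k} → Rel k → Fin k → Fin k → Bool
R ∋ i ∼ j = lookup (lookup R i) j

Sub : ℕ → Set
Sub k = Vec Bool k

_∋_ : ∀ {k} → Sub k → Fin k → Bool
S ∋ i = lookup S i

isEquivRel : ∀ {k} → Rel k → Bool
isEquivRel {k} R =
  ∀ᵇ k (λ i → R ∋ i ∼ i)
  ∧ ∀ᵇ k (λ i → ∀ᵇ k (λ j → (R ∋ i ∼ j) ⇒ᵇ (R ∋ j ∼ i)))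
  ∧ ∀ᵇ k (λ i → ∀ᵇ k (λ j → ∀ᵇ k (λ l → ((R ∋ i ∼ j) ∧ (R ∋ j ∼ l)) ⇒ᵇ (R ∋ i ∼ l))))

-- Set partitions of [n], represented (canonically) by their equivalence
-- relation "i, j lie in the same block".

record SetPartition (n : ℕ) : Set where
  constructor mkPartition
  field
    rel     : Rel n
    isEquiv : T (isEquivRel rel)
open SetPartition public

_⊢_∼_ : ∀ {n} → SetPartition n → Fin n → Fin n → Bool
λ' ⊢ i ∼ j = rel λ' ∋ i ∼ j

isFirst : ∀ {n} → SetPartition n → Fin n → Bool
isFirst {n} λ' i = ∀ᵇ n (λ j → (j <F i) ⇒ᵇ not (λ' ⊢ i ∼ j))

isLast : ∀ {n} → SetPartition n → Fin n → Bool
isLast {n} λ' i = ∀ᵇ n (λ j → (i <F j) ⇒ᵇ not (λ' ⊢ i ∼ j))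

isArc : ∀ {n} → SetPartition n → Fin n → Fin n → Bool
isArc {n} λ' i j =
  (i <F j) ∧ (λ' ⊢ i ∼ j)
  ∧ ∀ᵇ n (λ l → ((i <F l) ∧ (l <F j)) ⇒ᵇ not (λ' ⊢ i ∼ l))

record Pattern (k : ℕ) : Set where
  constructor mkPattern
  field
    P : SetPartition k
    F : Sub k
    L : Sub k
    A : Rel k
    C : Rel k
open Pattern public

strictlyIncreasing : ∀ {k n} → Vec (Fin n) k → Bool
strictlyIncreasing {k} s =
  ∀ᵇ k (λ i → ∀ᵇ k (λ j → (i <F j) ⇒ᵇ (lookup s i <F lookup s j)))

isOccurrence : ∀ {k n} → Pattern k → SetPartition n → Vec (Fin n) k → Bool
isOccurrence {k} p λ' s =
  strictlyIncreasing s
  ∧ ∀ᵇ k (λ i → ∀ᵇ k (λ j → (λ' ⊢ x i ∼ x j) ⇔ᵇ (P p ⊢ i ∼ j)))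
  ∧ ∀ᵇ k (λ i → (F p ∋ i) ⇒ᵇ isFirst λ' (x i))
  ∧ ∀ᵇ k (λ i → (L p ∋ i) ⇒ᵇ isLast λ' (x i))
  ∧ ∀ᵇ k (λ i → ∀ᵇ k (λ j → (A p ∋ i ∼ j) ⇒ᵇ isArc λ' (x i) (x j)))
  ∧ ∀ᵇ k (λ i → ∀ᵇ k (λ j → (C p ∋ i ∼ j) ⇒ᵇ adjacent (x i) (x j)))
  where
  x = lookup s

Occurrence : ∀ {k n} → Pattern k → SetPartition n → Set
Occurrence {k} {n} p λ' = Σ (Vec (Fin n) k) (λ s → T (isOccurrence p λ' s))

hitBy : ∀ {ka kb} → Vec (Fin kb) ka → (Fin ka → Bool) → Fin kb → Bool
hitBy {ka} m q i = ∃ᵇ ka (λ j → (lookup m j ≡F i) ∧ q j)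

hitBy₂ : ∀ {ka kb} → Vec (Fin kb) ka → (Fin ka → Fin ka → Bool) → Fin kb → Fin kb → Bool
hitBy₂ {ka} m q i i' =
  ∃ᵇ ka (λ j → ∃ᵇ ka (λ j' → (lookup m j ≡F i) ∧ (lookup m j' ≡F i') ∧ q j j'))

isMerge : ∀ {k₁ k₂ k₃} → Pattern k₁ → Pattern k₂ → Pattern k₃ →
          Vec (Fin k₃) k₁ → Vec (Fin k₃) k₂ → Bool
isMerge {k₁} {k₂} {k₃} p₁ p₂ p₃ m₁ m₂ =
  strictlyIncreasing m₁ ∧ strictlyIncreasing m₂
  ∧ ∀ᵇ k₃ (λ i → hitBy m₁ (λ _ → true) i ∨ hitBy m₂ (λ _ → true) i)
  ∧ ∀ᵇ k₁ (λ i → ∀ᵇ k₁ (λ j → (P p₃ ⊢ lookup m₁ i ∼ lookup m₁ j) ⇔ᵇ (P p₁ ⊢ i ∼ j)))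
  ∧ ∀ᵇ k₂ (λ i → ∀ᵇ k₂ (λ j → (P p₃ ⊢ lookup m₂ i ∼ lookup m₂ j) ⇔ᵇ (P p₂ ⊢ i ∼ j)))
  ∧ ∀ᵇ k₃ (λ i → (F p₃ ∋ i) ⇔ᵇ (hitBy m₁ (F p₁ ∋_) i ∨ hitBy m₂ (F p₂ ∋_) i))
  ∧ ∀ᵇ k₃ (λ i → (L p₃ ∋ i) ⇔ᵇ (hitBy m₁ (L p₁ ∋_) i ∨ hitBy m₂ (L p₂ ∋_) i))
  ∧ ∀ᵇ k₃ (λ i → ∀ᵇ k₃ (λ i' → (A p₃ ∋ i ∼ i')
        ⇔ᵇ (hitBy₂ m₁ (A p₁ ∋_∼_) i i' ∨ hitBy₂ m₂ (A p₂ ∋_∼_) i i')))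
  ∧ ∀ᵇ k₃ (λ i → ∀ᵇ k₃ (λ i' → (C p₃ ∋ i ∼ i')
        ⇔ᵇ (hitBy₂ m₁ (C p₁ ∋_∼_) i i' ∨ hitBy₂ m₂ (C p₂ ∋_∼_) i i')))

Merge : ∀ {k₁ k₂ k₃} → Pattern k₁ → Pattern k₂ → Pattern k₃ → Set
Merge {k₁} {k₂} {k₃} p₁ p₂ p₃ =
  Σ (Vec (Fin k₃) k₁ × Vec (Fin k₃) k₂) (λ m → T (isMerge p₁ p₂ p₃ (proj₁ m) (proj₂ m)))

OccPairs : ∀ {k₁ k₂ n} → Pattern k₁ → Pattern k₂ → SetPartition n → Set
OccPairs p₁ p₂ λ' = Occurrence p₁ λ' × Occurrence p₂ λ'

MergeTriples : ∀ {k₁ k₂ n} → Pattern k₁ → Pattern k₂ → SetPartition n → Set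
MergeTriples p₁ p₂ λ' =
  Σ ℕ (λ k₃ → Σ (Pattern k₃) (λ p₃ → Occurrence p₃ λ' × Merge p₁ p₂ p₃))

data Poly (k : ℕ) : Set where
  y    : Fin k → Poly k
  m    : Poly k
  con  : ℤ → Poly k
  _⊕_  : Poly k → Poly k → Poly k
  _⊗_  : Poly k → Poly k → Poly k

eval : ∀ {k} → Poly k → (Fin k → ℤ) → ℤ → ℤ
eval (y i)   ys mv = ys i
eval m       ys mv = mv
eval (con c) ys mv = c
eval (p ⊕ q) ys mv = eval p ys mv +ℤ eval q ys mv
eval (p ⊗ q) ys mv = eval p ys mv *ℤ eval q ys mv

-- element x ∈ Fin n denotes the integer x + 1 ∈ [n]
val : ∀ {n} → Fin n → ℤ
val x = + suc (toℕ x)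

evalAt : ∀ {k n} → Poly k → Vec (Fin n) k → ℤ
evalAt {k} {n} Q s = eval Q (λ i → val (lookup s i)) (+ n)

evalVia : ∀ {k k₃ n} → Poly k → Vec (Fin n) k₃ → Vec (Fin k₃) k → ℤ
evalVia {k} {k₃} {n} Q z mp = eval Q (λ i → val (lookup z (lookup mp i))) (+ n)

-- Given occurrences s₁ and s₂, let s₃ enumerate the union of their entries increasingly and let
-- mₐ record the positions of the entries of sₐ in s₃. The pattern P₃ is then forced: its blocks
-- are those of λ restricted to s₃, and its F, L, A, C data are the images under m₁, m₂ of those
-- of P₁ and P₂. Conversely a triple gives back sₐ = s₃ ∘ mₐ. The one substantive point is that s₃
-- is recovered from s₃ ∘ m₁ and s₃ ∘ m₂: since m₁ and m₂ cover [k₃], both s₃ and the interleaving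
-- of s₃ ∘ m₁ with s₃ ∘ m₂ are ascending with the same set of entries, and an ascending sequence
-- is determined by its set of entries. The polynomial identity holds because Qₐ is evaluated at
-- the same numbers, s₃ ∘ mₐ = sₐ.

module Submission where

open import Defs
open import Data.Bool using (Bool; true; false; _∧_; _∨_; T)
open import Data.Bool.Properties using (T-∧; T-∨; T-irrelevant; ∨-comm)
open import Data.Empty using (⊥-elim)
open import Data.Fin using (Fin; toℕ; _<_; _≤_) renaming (zero to fzero; suc to fsuc)
open import Data.Fin.Properties using (toℕ-injective; <-cmp; <-asym; <⇒≢; ≤-antisym; ≤-reflexive)
open import Data.Integer using (ℤ; _+_; _*_)
open import Data.List.Base using (allFin)
open import Data.List.Membership.Propositional using (lose)
open import Data.List.Membership.Propositional.Properties using (∈-allFin)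
import Data.List.Relation.Unary.All as All
open import Data.List.Relation.Unary.All.Properties using (all⁺; all⁻)
open import Data.List.Relation.Unary.Any using (satisfied)
open import Data.List.Relation.Unary.Any.Properties using (any⁺; any⁻)
open import Data.Nat using (ℕ; suc; z<s; s<s)
open import Data.Nat.Properties using (≡ᵇ⇒≡; ≡⇒≡ᵇ; <ᵇ⇒<; <⇒<ᵇ; <⇒≤; <-≤-trans)
open import Data.Product using (Σ; ∃; ∃₂; _×_; _,_; proj₁; proj₂)
open import Data.Product.Function.NonDependent.Propositional using (_×-⇔_)
open import Data.Sum using (_⊎_; inj₁; inj₂) renaming (map to ⊎-map; swap to ⊎-swap)
open import Data.Sum.Function.Propositional using (_⊎-⇔_)
open import Data.Vec using (Vec; []; _∷_; lookup; map; tabulate)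
open import Data.Vec.Properties using (lookup-map; map-∘; lookup∘tabulate)
open import Data.Vec.Relation.Binary.Pointwise.Extensional using (ext; Pointwise-≡⇒≡)
open import Function.Base using (_∘_)
open import Function.Bundles using (_⇔_; mk⇔; Equivalence; _⤖_; Bijection; mk↔ₛ′)
open import Function.Construct.Composition using (_⇔-∘_)
open import Function.Construct.Identity using (⇔-id)
open import Function.Properties.Inverse using (↔⇒⤖)
open import Relation.Binary.Definitions using (tri<; tri≈; tri>)
open import Relation.Binary.PropositionalEquality hiding ([_])
open import Relation.Nullary.Negation using (contradiction)

open Equivalence using (to; from)

∀ᵇ⇔ : ∀ {k} {p : Fin k → Bool} {B : Fin k → Set} →
      (∀ i → T (p i) ⇔ B i) → T (∀ᵇ k p) ⇔ (∀ i → B i)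
∀ᵇ⇔ {k} {p} e = mk⇔
  (λ t i → to (e i) (All.lookup (all⁺ p (allFin k) t) (∈-allFin i)))
  (λ f → all⁻ p {allFin k} (All.tabulate λ {i} _ → from (e i) (f i)))

∃ᵇ⇔ : ∀ {k} {p : Fin k → Bool} {B : Fin k → Set} →
      (∀ i → T (p i) ⇔ B i) → T (∃ᵇ k p) ⇔ ∃ B
∃ᵇ⇔ {k} {p} e = mk⇔
  (λ t → let i , pi = satisfied (any⁻ p (allFin k) t) in i , to (e i) pi)
  (λ (i , b) → any⁺ p (lose (∈-allFin i) (from (e i) b)))

∧⇔ : ∀ {a b} {A B : Set} → T a ⇔ A → T b ⇔ B → T (a ∧ b) ⇔ (A × B)
∧⇔ e f = (e ×-⇔ f) ⇔-∘ T-∧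

∨⇔ : ∀ {a b} {A B : Set} → T a ⇔ A → T b ⇔ B → T (a ∨ b) ⇔ (A ⊎ B)
∨⇔ e f = (e ⊎-⇔ f) ⇔-∘ T-∨

⇒ᵇ⇔ : ∀ {a b} {A B : Set} → T a ⇔ A → T b ⇔ B → T (a ⇒ᵇ b) ⇔ (A → B)
⇒ᵇ⇔ {false} e f = mk⇔ (λ _ x → ⊥-elim (from e x)) (λ _ → _)
⇒ᵇ⇔ {true}  e f = mk⇔ (λ t _ → to f t) (λ g → from f (g (to e _)))

⇔ᵇ⇔ : ∀ {a b} → T (a ⇔ᵇ b) ⇔ (a ≡ b)
⇔ᵇ⇔ {true}  {true}  = mk⇔ (λ _ → refl) (λ _ → _)
⇔ᵇ⇔ {true}  {false} = mk⇔ (λ ()) (λ ())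
⇔ᵇ⇔ {false} {true}  = mk⇔ (λ ()) (λ ())
⇔ᵇ⇔ {false} {false} = mk⇔ (λ _ → refl) (λ _ → _)

≡F⇔ : ∀ {k} {i j : Fin k} → T (i ≡F j) ⇔ (i ≡ j)
≡F⇔ {i = i} {j} = mk⇔ (λ t → toℕ-injective (≡ᵇ⇒≡ (toℕ i) (toℕ j) t))
                      (λ e → ≡⇒≡ᵇ (toℕ i) (toℕ j) (cong toℕ e))

<F⇔ : ∀ {k} {i j : Fin k} → T (i <F j) ⇔ (i < j)
<F⇔ {i = i} {j} = mk⇔ (<ᵇ⇒< (toℕ i) (toℕ j)) <⇒<ᵇ

record Ascending {k n} (s : Vec (Fin n) k) : Set where
  constructor ascending
  field monotone : ∀ {i j} → i < j → lookup s i < lookup s j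
open Ascending

record Image {k n} (v : Vec (Fin n) k) (x : Fin n) : Set where
  constructor _,_
  field
    index    : Fin k
    lookup≡  : lookup v index ≡ x

strictlyIncreasing⇔ : ∀ {k n} {s : Vec (Fin n) k} → T (strictlyIncreasing s) ⇔ Ascending s
strictlyIncreasing⇔ {s = s} =
  mk⇔ (λ f → ascending λ {i} {j} → f i j) (λ asc i j → monotone asc {i} {j})
  ⇔-∘ ∀ᵇ⇔ λ i → ∀ᵇ⇔ λ j → ⇒ᵇ⇔ (<F⇔ {i = i} {j}) (<F⇔ {i = lookup s i} {lookup s j})

hitBy⇔ : ∀ {ka kb} {v : Vec (Fin kb) ka} {q : Fin ka → Bool} {i} →
         T (hitBy v q i) ⇔ (∃ λ j → lookup v j ≡ i × T (q j))
hitBy⇔ = ∃ᵇ⇔ λ _ → ∧⇔ ≡F⇔ (⇔-id _)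

hitBy₂⇔ : ∀ {ka kb} {v : Vec (Fin kb) ka} {q : Fin ka → Fin ka → Bool} {i i'} →
          T (hitBy₂ v q i i') ⇔ (∃₂ λ j j' → lookup v j ≡ i × lookup v j' ≡ i' × T (q j j'))
hitBy₂⇔ = ∃ᵇ⇔ λ _ → ∃ᵇ⇔ λ _ → ∧⇔ ≡F⇔ (∧⇔ ≡F⇔ (⇔-id _))

image⇔ : ∀ {ka kb} {v : Vec (Fin kb) ka} {i} → T (hitBy v (λ _ → true) i) ⇔ Image v i
image⇔ {v = v} = mk⇔ (λ (j , e , _) → j , e) (λ (j , e) → j , e , _) ⇔-∘ hitBy⇔ {v = v}

record IsEquivRel {k} (R : Rel k) : Set where
  field
    reflexive  : ∀ i → T (R ∋ i ∼ i)
    symmetric  : ∀ i j → T (R ∋ i ∼ j) → T (R ∋ j ∼ i)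
    transitive : ∀ i j l → T (R ∋ i ∼ j) → T (R ∋ j ∼ l) → T (R ∋ i ∼ l)

isEquivRel⇔ : ∀ {k} {R : Rel k} → T (isEquivRel R) ⇔ IsEquivRel R
isEquivRel⇔ =
  mk⇔ (λ (r , s , t) → record { reflexive = r ; symmetric = s
                             ; transitive = λ i j l u v → t i j l (u , v) })
      (λ e → let open IsEquivRel e in
             reflexive , symmetric , λ i j l (u , v) → transitive i j l u v)
  ⇔-∘ ∧⇔ (∀ᵇ⇔ λ _ → (⇔-id _))
         (∧⇔ (∀ᵇ⇔ λ _ → ∀ᵇ⇔ λ _ → ⇒ᵇ⇔ (⇔-id _) (⇔-id _))
             (∀ᵇ⇔ λ _ → ∀ᵇ⇔ λ _ → ∀ᵇ⇔ λ _ → ⇒ᵇ⇔ T-∧ (⇔-id _)))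

record IsOccurrence {k n} (p : Pattern k) (λ' : SetPartition n) (s : Vec (Fin n) k) : Set where
  field
    isAscending : Ascending s
    blocks      : ∀ i j → (λ' ⊢ lookup s i ∼ lookup s j) ≡ (P p ⊢ i ∼ j)
    firsts      : ∀ i → T (F p ∋ i) → T (isFirst λ' (lookup s i))
    lasts       : ∀ i → T (L p ∋ i) → T (isLast λ' (lookup s i))
    arcs        : ∀ i j → T (A p ∋ i ∼ j) → T (isArc λ' (lookup s i) (lookup s j))
    adjacencies : ∀ i j → T (C p ∋ i ∼ j) → T (adjacent (lookup s i) (lookup s j))

-- Opaque, so that the round-trip equations below compare decoded proofs syntactically; unfolding
-- the Boolean decoding there is prohibitively slow.
opaque
  isOccurrence⇔ : ∀ {k n} {p : Pattern k} {λ' : SetPartition n} {s} →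
                  T (isOccurrence p λ' s) ⇔ IsOccurrence p λ' s
  isOccurrence⇔ {s = s} =
    mk⇔ (λ (a , b , f , l , r , c) → record
            { isAscending = a ; blocks = b ; firsts = f ; lasts = l ; arcs = r ; adjacencies = c })
        (λ o → let open IsOccurrence o in
               isAscending , blocks , firsts , lasts , arcs , adjacencies)
    ⇔-∘ ∧⇔ (strictlyIncreasing⇔ {s = s})
       (∧⇔ (∀ᵇ⇔ λ _ → ∀ᵇ⇔ λ _ → ⇔ᵇ⇔)
       (∧⇔ (∀ᵇ⇔ λ _ → ⇒ᵇ⇔ (⇔-id _) (⇔-id _))
       (∧⇔ (∀ᵇ⇔ λ _ → ⇒ᵇ⇔ (⇔-id _) (⇔-id _))
       (∧⇔ (∀ᵇ⇔ λ _ → ∀ᵇ⇔ λ _ → ⇒ᵇ⇔ (⇔-id _) (⇔-id _))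
           (∀ᵇ⇔ λ _ → ∀ᵇ⇔ λ _ → ⇒ᵇ⇔ (⇔-id _) (⇔-id _))))))

module _ {k₁ k₂ k₃} (p₁ : Pattern k₁) (p₂ : Pattern k₂)
         (m₁ : Vec (Fin k₃) k₁) (m₂ : Vec (Fin k₃) k₂) where

  firstsOf lastsOf : Fin k₃ → Bool
  firstsOf i = hitBy m₁ (F p₁ ∋_) i ∨ hitBy m₂ (F p₂ ∋_) i
  lastsOf  i = hitBy m₁ (L p₁ ∋_) i ∨ hitBy m₂ (L p₂ ∋_) i

  arcsOf adjacenciesOf : Fin k₃ → Fin k₃ → Bool
  arcsOf        i i' = hitBy₂ m₁ (A p₁ ∋_∼_) i i' ∨ hitBy₂ m₂ (A p₂ ∋_∼_) i i'
  adjacenciesOf i i' = hitBy₂ m₁ (C p₁ ∋_∼_) i i' ∨ hitBy₂ m₂ (C p₂ ∋_∼_) i i'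

record IsMerge {k₁ k₂ k₃} (p₁ : Pattern k₁) (p₂ : Pattern k₂) (p₃ : Pattern k₃)
               (m₁ : Vec (Fin k₃) k₁) (m₂ : Vec (Fin k₃) k₂) : Set where
  field
    isAscending₁ : Ascending m₁
    isAscending₂ : Ascending m₂
    covers      : ∀ i → Image m₁ i ⊎ Image m₂ i
    blocks₁     : ∀ i j → (P p₃ ⊢ lookup m₁ i ∼ lookup m₁ j) ≡ (P p₁ ⊢ i ∼ j)
    blocks₂     : ∀ i j → (P p₃ ⊢ lookup m₂ i ∼ lookup m₂ j) ≡ (P p₂ ⊢ i ∼ j)
    firsts      : ∀ i → (F p₃ ∋ i) ≡ firstsOf p₁ p₂ m₁ m₂ i
    lasts       : ∀ i → (L p₃ ∋ i) ≡ lastsOf p₁ p₂ m₁ m₂ i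
    arcs        : ∀ i i' → (A p₃ ∋ i ∼ i') ≡ arcsOf p₁ p₂ m₁ m₂ i i'
    adjacencies : ∀ i i' → (C p₃ ∋ i ∼ i') ≡ adjacenciesOf p₁ p₂ m₁ m₂ i i'

opaque
  isMerge⇔ : ∀ {k₁ k₂ k₃} {p₁ : Pattern k₁} {p₂ : Pattern k₂} {p₃ : Pattern k₃} {m₁ m₂} →
             T (isMerge p₁ p₂ p₃ m₁ m₂) ⇔ IsMerge p₁ p₂ p₃ m₁ m₂
  isMerge⇔ {m₁ = m₁} {m₂} =
    mk⇔ (λ (a₁ , a₂ , c , b₁ , b₂ , f , l , r , d) → record
            { isAscending₁ = a₁ ; isAscending₂ = a₂ ; covers = c ; blocks₁ = b₁ ; blocks₂ = b₂
            ; firsts = f ; lasts = l ; arcs = r ; adjacencies = d })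
        (λ g → let open IsMerge g in
               isAscending₁ , isAscending₂ , covers , blocks₁ , blocks₂ ,
               firsts , lasts , arcs , adjacencies)
    ⇔-∘ ∧⇔ (strictlyIncreasing⇔ {s = m₁}) (∧⇔ (strictlyIncreasing⇔ {s = m₂})
       (∧⇔ (∀ᵇ⇔ λ _ → ∨⇔ (image⇔ {v = m₁}) (image⇔ {v = m₂}))
       (∧⇔ (∀ᵇ⇔ λ _ → ∀ᵇ⇔ λ _ → ⇔ᵇ⇔) (∧⇔ (∀ᵇ⇔ λ _ → ∀ᵇ⇔ λ _ → ⇔ᵇ⇔)
       (∧⇔ (∀ᵇ⇔ λ _ → ⇔ᵇ⇔) (∧⇔ (∀ᵇ⇔ λ _ → ⇔ᵇ⇔)
       (∧⇔ (∀ᵇ⇔ λ _ → ∀ᵇ⇔ λ _ → ⇔ᵇ⇔) (∀ᵇ⇔ λ _ → ∀ᵇ⇔ λ _ → ⇔ᵇ⇔))))))))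

-- Ascending sequences

module _ {n : ℕ} where

  ascending-head : ∀ {k x} {u : Vec (Fin n) k} → Ascending (x ∷ u) → ∀ j → x < lookup u j
  ascending-head asc j = monotone asc {fzero} {fsuc j} z<s

  ascending-tail : ∀ {k x} {u : Vec (Fin n) k} → Ascending (x ∷ u) → Ascending u
  ascending-tail asc = ascending λ i<j → monotone asc (s<s i<j)

  ascending-∷ : ∀ {k x} {u : Vec (Fin n) k} →
                (∀ j → x < lookup u j) → Ascending u → Ascending (x ∷ u)
  ascending-∷ {x = x} {u} x<u asc = ascending monotone-∷
    where
    monotone-∷ : ∀ {i j} → i < j → lookup (x ∷ u) i < lookup (x ∷ u) j
    monotone-∷ {fzero}  {fsuc j} _         = x<u j
    monotone-∷ {fsuc i} {fsuc j} (s<s i<j) = monotone asc i<j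

  ascending-injective : ∀ {k} {u : Vec (Fin n) k} → Ascending u →
                        ∀ {i j} → lookup u i ≡ lookup u j → i ≡ j
  ascending-injective asc {i} {j} eq with <-cmp i j
  ... | tri< i<j _ _ = contradiction eq (<⇒≢ (monotone asc i<j))
  ... | tri≈ _ i≡j _ = i≡j
  ... | tri> _ _ j<i = contradiction (sym eq) (<⇒≢ (monotone asc j<i))

  ascending-reflects-< : ∀ {k} {u : Vec (Fin n) k} → Ascending u →
                         ∀ {i j} → lookup u i < lookup u j → i < j
  ascending-reflects-< asc {i} {j} ui<uj with <-cmp i j
  ... | tri< i<j _ _ = i<j
  ... | tri≈ _ refl _ = contradiction refl (<⇒≢ ui<uj)
  ... | tri> _ _ j<i = contradiction ui<uj (<-asym (monotone asc j<i))

  module _ {k} {z : Vec (Fin n) k} (asc : Ascending z) where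

    ascending-map : ∀ {a} {v : Vec (Fin k) a} → Ascending v → Ascending (map (lookup z) v)
    ascending-map {v = v} ascᵥ = ascending λ {i} {j} i<j →
      subst₂ _<_ (sym (lookup-map i (lookup z) v)) (sym (lookup-map j (lookup z) v))
             (monotone asc (monotone ascᵥ i<j))

    ascending-map⁻ : ∀ {a} {v : Vec (Fin k) a} → Ascending (map (lookup z) v) → Ascending v
    ascending-map⁻ {v = v} ascᵥ = ascending λ {i} {j} i<j →
      ascending-reflects-< asc
        (subst₂ _<_ (lookup-map i (lookup z) v) (lookup-map j (lookup z) v) (monotone ascᵥ i<j))

  ascending-least : ∀ {k x w} {u : Vec (Fin n) k} → Ascending (x ∷ u) → Image (x ∷ u) w → x ≤ w
  ascending-least asc (fzero  , refl) = ≤-reflexive refl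
  ascending-least asc (fsuc j , refl) = <⇒≤ (ascending-head asc j)

  image-tail : ∀ {k x w} {u : Vec (Fin n) k} → Image (x ∷ u) w → x < w → Image u w
  image-tail (fzero  , refl) x<x = contradiction refl (<⇒≢ x<x)
  image-tail (fsuc j , e)    _   = j , e

  ascending-unique : ∀ {k l} {u : Vec (Fin n) k} {v : Vec (Fin n) l} →
                     Ascending u → Ascending v →
                     (∀ {w} → Image u w → Image v w) → (∀ {w} → Image v w → Image u w) →
                     _≡_ {A = ∃ (Vec (Fin n))} (k , u) (l , v)
  ascending-unique {u = []}    {[]}    _   _   _   _   = refl
  ascending-unique {u = []}    {_ ∷ _} _   _   _   v⊆u with v⊆u (fzero , refl)
  ... | () , _
  ascending-unique {u = _ ∷ _} {[]}    _   _   u⊆v _   with u⊆v (fzero , refl)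
  ... | () , _
  ascending-unique {u = x ∷ u} {x′ ∷ v} ascᵤ ascᵥ u⊆v v⊆u
    with ≤-antisym (ascending-least ascᵤ (v⊆u (fzero , refl)))
                   (ascending-least ascᵥ (u⊆v (fzero , refl)))
  ... | refl = cong (λ (k , u) → suc k , x ∷ u)
    (ascending-unique (ascending-tail ascᵤ) (ascending-tail ascᵥ)
      (λ (j , e) → image-tail (u⊆v (fsuc j , e)) (subst (x <_) e (ascending-head ascᵤ j)))
      (λ (j , e) → image-tail (v⊆u (fsuc j , e)) (subst (x <_) e (ascending-head ascᵥ j))))

  map-lookup-injective : ∀ {k a} {z : Vec (Fin n) k} → Ascending z →
                     ∀ {v v′ : Vec (Fin k) a} → map (lookup z) v ≡ map (lookup z) v′ → v ≡ v′
  map-lookup-injective {z = z} asc {v} {v′} eq =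
    Pointwise-≡⇒≡ (ext λ i → ascending-injective asc (begin
    lookup z (lookup v i)      ≡⟨ lookup-map i (lookup z) v ⟨
    lookup (map (lookup z) v) i  ≡⟨ cong (λ u → lookup u i) eq ⟩
    lookup (map (lookup z) v′) i ≡⟨ lookup-map i (lookup z) v′ ⟩
    lookup z (lookup v′ i)     ∎))
    where open ≡-Reasoning

  module _ {k a} {z : Vec (Fin n) k} {v : Vec (Fin k) a} {xs : Vec (Fin n) a}
           (reads : map (lookup z) v ≡ xs) where

    lookup-reads : ∀ j → lookup z (lookup v j) ≡ lookup xs j
    lookup-reads j = trans (sym (lookup-map j (lookup z) v)) (cong (λ u → lookup u j) reads)

    image-reads : ∀ {t : Fin k} → Image v t → Image xs (lookup z t)
    image-reads (j , refl) = j , sym (lookup-reads j)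

    reads-image : ∀ {w : Fin n} → Image xs w → Image z w
    reads-image (j , refl) = lookup v j , lookup-reads j

    hitBy-reads : ∀ {q : Fin a → Bool} (Q : Fin n → Set) → (∀ j → T (q j) → Q (lookup xs j)) →
                  ∀ {i} → T (hitBy v q i) → Q (lookup z i)
    hitBy-reads {q} Q h t with to (hitBy⇔ {v = v} {q}) t
    ... | j , refl , qj = subst Q (sym (lookup-reads j)) (h j qj)

    hitBy₂-reads : ∀ {q : Fin a → Fin a → Bool} (Q : Fin n → Fin n → Set) →
                   (∀ j j′ → T (q j j′) → Q (lookup xs j) (lookup xs j′)) →
                   ∀ {i i′} → T (hitBy₂ v q i i′) → Q (lookup z i) (lookup z i′)
    hitBy₂-reads {q} Q h t with to (hitBy₂⇔ {v = v} {q}) t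
    ... | j , j′ , refl , refl , qjj′ =
      subst₂ Q (sym (lookup-reads j)) (sym (lookup-reads j′)) (h j j′ qjj′)

-- Interleaving two ascending sequences

record Interleaving (n a b : ℕ) : Set where
  constructor interleaving
  field
    len  : ℕ
    seq  : Vec (Fin n) len
    pos₁ : Vec (Fin len) a
    pos₂ : Vec (Fin len) b
open Interleaving

record Interleaves {n a b} (r : Interleaving n a b) (xs : Vec (Fin n) a) (ys : Vec (Fin n) b) :
                   Set where
  field
    reads₁ : map (lookup (seq r)) (pos₁ r) ≡ xs
    reads₂ : map (lookup (seq r)) (pos₂ r) ≡ ys
    covering : ∀ t → Image (pos₁ r) t ⊎ Image (pos₂ r) t
open Interleaves

module _ {n : ℕ} where

  mark : ∀ {k a} → Vec (Fin k) a → Vec (Fin (suc k)) (suc a)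
  mark v = fzero ∷ map fsuc v

  consˡ : ∀ {a b} → Fin n → Interleaving n a b → Interleaving n (suc a) b
  consˡ x r = interleaving (suc (len r)) (x ∷ seq r) (mark (pos₁ r)) (map fsuc (pos₂ r))

  consʳ : ∀ {a b} → Fin n → Interleaving n a b → Interleaving n a (suc b)
  consʳ x r = interleaving (suc (len r)) (x ∷ seq r) (map fsuc (pos₁ r)) (mark (pos₂ r))

  consᵇ : ∀ {a b} → Fin n → Interleaving n a b → Interleaving n (suc a) (suc b)
  consᵇ x r = interleaving (suc (len r)) (x ∷ seq r) (mark (pos₁ r)) (mark (pos₂ r))

  interleave : ∀ {a b} → Vec (Fin n) a → Vec (Fin n) b → Interleaving n a b
  interleave []       []        = interleaving 0 [] [] []
  interleave []       (x′ ∷ ys) = consʳ x′ (interleave [] ys)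
  interleave (x ∷ xs) []        = consˡ x (interleave xs [])
  interleave (x ∷ xs) (x′ ∷ ys) with <-cmp x x′
  ... | tri< _ _ _ = consˡ x  (interleave xs (x′ ∷ ys))
  ... | tri≈ _ _ _ = consᵇ x  (interleave xs ys)
  ... | tri> _ _ _ = consʳ x′ (interleave (x ∷ xs) ys)

  reads-shift : ∀ {k a} (x : Fin n) (z : Vec (Fin n) k) (v : Vec (Fin k) a) →
                map (lookup (x ∷ z)) (map fsuc v) ≡ map (lookup z) v
  reads-shift x z v = sym (map-∘ (lookup (x ∷ z)) fsuc v)

  module _ {k a} (v : Vec (Fin k) a) {t : Fin k} where

    image-shift : Image v t → Image (map fsuc v) (fsuc t)
    image-shift (j , e) = j , trans (lookup-map j fsuc v) (cong fsuc e)

    image-mark : Image v t → Image (mark v) (fsuc t)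
    image-mark h = let j , e = image-shift h in fsuc j , e

  module _ {a b} {x : Fin n} {r : Interleaving n a b} {xs ys} (I : Interleaves r xs ys) where

    consˡ-interleaves : Interleaves (consˡ x r) (x ∷ xs) ys
    consˡ-interleaves = record
      { reads₁ = cong (x ∷_) (trans (reads-shift x (seq r) (pos₁ r)) (reads₁ I))
      ; reads₂ = trans (reads-shift x (seq r) (pos₂ r)) (reads₂ I)
      ; covering = λ { fzero    → inj₁ (fzero , refl)
                     ; (fsuc t) → ⊎-map (image-mark (pos₁ r)) (image-shift (pos₂ r)) (covering I t) }
      }

    consʳ-interleaves : Interleaves (consʳ x r) xs (x ∷ ys)
    consʳ-interleaves = record
      { reads₁ = trans (reads-shift x (seq r) (pos₁ r)) (reads₁ I)
      ; reads₂ = cong (x ∷_) (trans (reads-shift x (seq r) (pos₂ r)) (reads₂ I))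
      ; covering = λ { fzero    → inj₂ (fzero , refl)
                     ; (fsuc t) → ⊎-map (image-shift (pos₁ r)) (image-mark (pos₂ r)) (covering I t) }
      }

    consᵇ-interleaves : Interleaves (consᵇ x r) (x ∷ xs) (x ∷ ys)
    consᵇ-interleaves = record
      { reads₁ = cong (x ∷_) (trans (reads-shift x (seq r) (pos₁ r)) (reads₁ I))
      ; reads₂ = cong (x ∷_) (trans (reads-shift x (seq r) (pos₂ r)) (reads₂ I))
      ; covering = λ { fzero    → inj₁ (fzero , refl)
                     ; (fsuc t) → ⊎-map (image-mark (pos₁ r)) (image-mark (pos₂ r)) (covering I t) }
      }

  module _ {a b} {r : Interleaving n a b} {xs ys} (I : Interleaves r xs ys) where

    interleaves-image : ∀ {w : Fin n} → Image (seq r) w → Image xs w ⊎ Image ys w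
    interleaves-image (t , refl) =
      ⊎-map (image-reads {z = seq r} (reads₁ I)) (image-reads {z = seq r} (reads₂ I)) (covering I t)

    interleaves-above : ∀ {w : Fin n} → (∀ i → w < lookup xs i) → (∀ i → w < lookup ys i) →
                        ∀ j → w < lookup (seq r) j
    interleaves-above {w} w<xs w<ys j with interleaves-image (j , refl)
    ... | inj₁ (i , e) = subst (w <_) e (w<xs i)
    ... | inj₂ (i , e) = subst (w <_) e (w<ys i)

  interleave-interleaves : ∀ {a b} (xs : Vec (Fin n) a) (ys : Vec (Fin n) b) →
                           Interleaves (interleave xs ys) xs ys
  interleave-interleaves []       []        =
    record { reads₁ = refl ; reads₂ = refl ; covering = λ () }
  interleave-interleaves []       (x′ ∷ ys) = consʳ-interleaves (interleave-interleaves [] ys)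
  interleave-interleaves (x ∷ xs) []        = consˡ-interleaves (interleave-interleaves xs [])
  interleave-interleaves (x ∷ xs) (x′ ∷ ys) with <-cmp x x′
  ... | tri< _ _    _ = consˡ-interleaves (interleave-interleaves xs (x′ ∷ ys))
  ... | tri≈ _ refl _ = consᵇ-interleaves (interleave-interleaves xs ys)
  ... | tri> _ _    _ = consʳ-interleaves (interleave-interleaves (x ∷ xs) ys)

  interleave-ascending : ∀ {a b} (xs : Vec (Fin n) a) (ys : Vec (Fin n) b) →
                         Ascending xs → Ascending ys → Ascending (seq (interleave xs ys))
  interleave-ascending []       []        _    _    = ascending λ { {()} }
  interleave-ascending []       (x′ ∷ ys) ascₓ ascᵧ =
    ascending-∷ (interleaves-above (interleave-interleaves [] ys) (λ ()) (ascending-head ascᵧ))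
                (interleave-ascending [] ys ascₓ (ascending-tail ascᵧ))
  interleave-ascending (x ∷ xs) []        ascₓ ascᵧ =
    ascending-∷ (interleaves-above (interleave-interleaves xs []) (ascending-head ascₓ) (λ ()))
                (interleave-ascending xs [] (ascending-tail ascₓ) ascᵧ)
  interleave-ascending (x ∷ xs) (x′ ∷ ys) ascₓ ascᵧ with <-cmp x x′
  ... | tri< x<x′ _ _ =
    ascending-∷ (interleaves-above (interleave-interleaves xs (x′ ∷ ys)) (ascending-head ascₓ)
                  (λ i → <-≤-trans x<x′ (ascending-least ascᵧ (i , refl))))
                (interleave-ascending xs (x′ ∷ ys) (ascending-tail ascₓ) ascᵧ)
  ... | tri≈ _ refl _ =
    ascending-∷ (interleaves-above (interleave-interleaves xs ys)
                  (ascending-head ascₓ) (ascending-head ascᵧ))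
                (interleave-ascending xs ys (ascending-tail ascₓ) (ascending-tail ascᵧ))
  ... | tri> _ _ x′<x =
    ascending-∷ (interleaves-above (interleave-interleaves (x ∷ xs) ys)
                  (λ i → <-≤-trans x′<x (ascending-least ascₓ (i , refl))) (ascending-head ascᵧ))
                (interleave-ascending (x ∷ xs) ys ascₓ (ascending-tail ascᵧ))

  module _ {k a b} {z : Vec (Fin n) k} {m₁ : Vec (Fin k) a} {m₂ : Vec (Fin k) b}
           (asc : Ascending z) where

    interleaving-≡ : (r : Interleaving n a b) → _≡_ {A = ∃ (Vec (Fin n))} (len r , seq r) (k , z) →
                     Interleaves r (map (lookup z) m₁) (map (lookup z) m₂) →
                     r ≡ interleaving k z m₁ m₂
    interleaving-≡ (interleaving _ _ _ _) refl I =
      cong₂ (interleaving k z) (map-lookup-injective asc (reads₁ I))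
                               (map-lookup-injective asc (reads₂ I))

    interleave-unique : Ascending m₁ → Ascending m₂ → (∀ t → Image m₁ t ⊎ Image m₂ t) →
                        interleave (map (lookup z) m₁) (map (lookup z) m₂) ≡ interleaving k z m₁ m₂
    interleave-unique asc₁ asc₂ cov = interleaving-≡ (interleave xs ys) same-entries I
      where
      xs = map (lookup z) m₁
      ys = map (lookup z) m₂
      I = interleave-interleaves xs ys
      within-z : ∀ {w} → Image (seq (interleave xs ys)) w → Image z w
      within-z h with interleaves-image I h
      ... | inj₁ h₁ = reads-image refl h₁
      ... | inj₂ h₂ = reads-image refl h₂
      covers-z : ∀ {w} → Image z w → Image (seq (interleave xs ys)) w
      covers-z (t , refl) with cov t
      ... | inj₁ h₁ = reads-image (reads₁ I) (image-reads {z = z} refl h₁)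
      ... | inj₂ h₂ = reads-image (reads₂ I) (image-reads {z = z} refl h₂)
      same-entries : _≡_ {A = ∃ (Vec (Fin n))} (_ , seq (interleave xs ys)) (k , z)
      same-entries = ascending-unique
        (interleave-ascending xs ys (ascending-map asc asc₁) (ascending-map asc asc₂)) asc
        within-z covers-z

-- Restricted partitions and induced patterns

relOf : ∀ {k} → (Fin k → Fin k → Bool) → Rel k
relOf f = tabulate λ i → tabulate (f i)

relOf-∋ : ∀ {k} (f : Fin k → Fin k → Bool) i j → (relOf f ∋ i ∼ j) ≡ f i j
relOf-∋ f i j = trans (cong (λ row → lookup row j) (lookup∘tabulate _ i)) (lookup∘tabulate (f i) j)

Sub-ext : ∀ {k} {S S′ : Sub k} → (∀ i → (S ∋ i) ≡ (S′ ∋ i)) → S ≡ S′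
Sub-ext h = Pointwise-≡⇒≡ (ext h)

Rel-ext : ∀ {k} {R R′ : Rel k} → (∀ i j → (R ∋ i ∼ j) ≡ (R′ ∋ i ∼ j)) → R ≡ R′
Rel-ext h = Pointwise-≡⇒≡ (ext λ i → Pointwise-≡⇒≡ (ext (h i)))

partition-≡ : ∀ {k} {π π′ : SetPartition k} → rel π ≡ rel π′ → π ≡ π′
partition-≡ {π = mkPartition R e} {mkPartition .R e′} refl =
  cong (mkPartition R) (T-irrelevant e e′)

pattern-≡ : ∀ {k} {p q : Pattern k} → rel (P p) ≡ rel (P q) →
            F p ≡ F q → L p ≡ L q → A p ≡ A q → C p ≡ C q → p ≡ q
pattern-≡ {p = mkPattern π _ _ _ _} {mkPattern π′ _ _ _ _} eqP refl refl refl refl =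
  cong (λ π → mkPattern π _ _ _ _) (partition-≡ eqP)

restrict : ∀ {k n} → SetPartition n → Vec (Fin n) k → SetPartition k
restrict λ' z = mkPartition R (from (isEquivRel⇔ {R = R}) record
  { reflexive  = λ i → ∼⁺ (reflexive (lookup z i))
  ; symmetric  = λ i j i∼j → ∼⁺ (symmetric _ _ (∼⁻ i∼j))
  ; transitive = λ i j l i∼j j∼l → ∼⁺ (transitive _ _ _ (∼⁻ i∼j) (∼⁻ j∼l))
  })
  where
  open IsEquivRel (to (isEquivRel⇔ {R = rel λ'}) (isEquiv λ'))
  R = relOf λ i j → λ' ⊢ lookup z i ∼ lookup z j
  ∼⁺ : ∀ {i j} → T (λ' ⊢ lookup z i ∼ lookup z j) → T (R ∋ i ∼ j)
  ∼⁺ {i} {j} = subst T (sym (relOf-∋ _ i j))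
  ∼⁻ : ∀ {i j} → T (R ∋ i ∼ j) → T (λ' ⊢ lookup z i ∼ lookup z j)
  ∼⁻ {i} {j} = subst T (relOf-∋ _ i j)

restrict-∼ : ∀ {k n} (λ' : SetPartition n) (z : Vec (Fin n) k) i j →
             (restrict λ' z ⊢ i ∼ j) ≡ (λ' ⊢ lookup z i ∼ lookup z j)
restrict-∼ λ' z = relOf-∋ _

swap-merge : ∀ {k₁ k₂ k₃} {p₁ : Pattern k₁} {p₂ : Pattern k₂} {p₃ : Pattern k₃} {m₁ m₂} →
             IsMerge p₁ p₂ p₃ m₁ m₂ → IsMerge p₂ p₁ p₃ m₂ m₁
swap-merge {p₁ = p₁} {m₁ = m₁} g = record
  { isAscending₁ = isAscending₂ ; isAscending₂ = isAscending₁
  ; covers       = ⊎-swap ∘ covers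
  ; blocks₁      = blocks₂ ; blocks₂ = blocks₁
  ; firsts       = λ i → trans (firsts i) (∨-comm (hitBy m₁ (F p₁ ∋_) i) _)
  ; lasts        = λ i → trans (lasts i) (∨-comm (hitBy m₁ (L p₁ ∋_) i) _)
  ; arcs         = λ i i′ → trans (arcs i i′) (∨-comm (hitBy₂ m₁ (A p₁ ∋_∼_) i i′) _)
  ; adjacencies  = λ i i′ → trans (adjacencies i i′) (∨-comm (hitBy₂ m₁ (C p₁ ∋_∼_) i i′) _)
  }
  where open IsMerge g

module _ {k₁ k₂ k₃ n} {p₁ : Pattern k₁} {p₂ : Pattern k₂} {p₃ : Pattern k₃} {λ' : SetPartition n}
         {z : Vec (Fin n) k₃} {m₁ m₂} (o : IsOccurrence p₃ λ' z) (g : IsMerge p₁ p₂ p₃ m₁ m₂) where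

  private
    module o = IsOccurrence o
    module g = IsMerge g
    xs = map (lookup z) m₁
    lookup-xs : ∀ i → lookup xs i ≡ lookup z (lookup m₁ i)
    lookup-xs i = lookup-map i (lookup z) m₁
    embed : ∀ {b h₂ : Fin k₃ → Bool} {q : Fin k₁ → Bool} →
            (∀ i → b i ≡ hitBy m₁ q i ∨ h₂ i) → ∀ i → T (q i) → T (b (lookup m₁ i))
    embed {q = q} eq i t =
      subst T (sym (eq (lookup m₁ i))) (from T-∨ (inj₁ (from (hitBy⇔ {v = m₁} {q}) (i , refl , t))))
    embed₂ : ∀ {b h₂ : Fin k₃ → Fin k₃ → Bool} {q : Fin k₁ → Fin k₁ → Bool} →
             (∀ i i′ → b i i′ ≡ hitBy₂ m₁ q i i′ ∨ h₂ i i′) →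
             ∀ i j → T (q i j) → T (b (lookup m₁ i) (lookup m₁ j))
    embed₂ {q = q} eq i j t =
      subst T (sym (eq _ _))
        (from T-∨ (inj₁ (from (hitBy₂⇔ {v = m₁} {q}) (i , j , refl , refl , t))))

  occurrence-along-merge : IsOccurrence p₁ λ' (map (lookup z) m₁)
  occurrence-along-merge = record
    { isAscending = ascending-map o.isAscending g.isAscending₁
    ; blocks      = λ i j → trans (cong₂ (λ' ⊢_∼_) (lookup-xs i) (lookup-xs j))
                                  (trans (o.blocks _ _) (g.blocks₁ i j))
    ; firsts      = λ i t → subst (T ∘ isFirst λ') (sym (lookup-xs i))
                                    (o.firsts _ (embed g.firsts i t))
    ; lasts       = λ i t → subst (T ∘ isLast λ') (sym (lookup-xs i))
                                    (o.lasts _ (embed g.lasts i t))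
    ; arcs        = λ i j t → subst₂ (λ u w → T (isArc λ' u w)) (sym (lookup-xs i))
                                     (sym (lookup-xs j)) (o.arcs _ _ (embed₂ g.arcs i j t))
    ; adjacencies = λ i j t → subst₂ (λ u w → T (adjacent u w)) (sym (lookup-xs i))
                                     (sym (lookup-xs j)) (o.adjacencies _ _ (embed₂ g.adjacencies i j t))
    }

module Correspondence {k₁ k₂ n} (p₁ : Pattern k₁) (p₂ : Pattern k₂) (λ' : SetPartition n) where

  inducedPattern : (r : Interleaving n k₁ k₂) → Pattern (len r)
  inducedPattern r = mkPattern (restrict λ' (seq r))
    (tabulate (firstsOf p₁ p₂ (pos₁ r) (pos₂ r))) (tabulate (lastsOf p₁ p₂ (pos₁ r) (pos₂ r)))
    (relOf (arcsOf p₁ p₂ (pos₁ r) (pos₂ r))) (relOf (adjacenciesOf p₁ p₂ (pos₁ r) (pos₂ r)))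

  module _ {r : Interleaving n k₁ k₂} {xs ys} (asc : Ascending (seq r)) (I : Interleaves r xs ys)
           (o₁ : IsOccurrence p₁ λ' xs) (o₂ : IsOccurrence p₂ λ' ys) where

    private
      module o₁ = IsOccurrence o₁
      module o₂ = IsOccurrence o₂
      module I = Interleaves I
      z = seq r
      m₁ = pos₁ r
      m₂ = pos₂ r
      hitBy-either : ∀ {q₁ q₂} (Q : Fin n → Set) →
                     (∀ j → T (q₁ j) → Q (lookup xs j)) → (∀ j → T (q₂ j) → Q (lookup ys j)) →
                     ∀ {i} → T (hitBy m₁ q₁ i ∨ hitBy m₂ q₂ i) → Q (lookup z i)
      hitBy-either Q h₁ h₂ t with to T-∨ t
      ... | inj₁ t₁ = hitBy-reads {z = z} {v = m₁} I.reads₁ Q h₁ t₁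
      ... | inj₂ t₂ = hitBy-reads {z = z} {v = m₂} I.reads₂ Q h₂ t₂
      hitBy₂-either : ∀ {q₁ q₂} (Q : Fin n → Fin n → Set) →
                      (∀ j j′ → T (q₁ j j′) → Q (lookup xs j) (lookup xs j′)) →
                      (∀ j j′ → T (q₂ j j′) → Q (lookup ys j) (lookup ys j′)) →
                      ∀ {i i′} → T (hitBy₂ m₁ q₁ i i′ ∨ hitBy₂ m₂ q₂ i i′) →
                      Q (lookup z i) (lookup z i′)
      hitBy₂-either Q h₁ h₂ t with to T-∨ t
      ... | inj₁ t₁ = hitBy₂-reads {z = z} {v = m₁} I.reads₁ Q h₁ t₁
      ... | inj₂ t₂ = hitBy₂-reads {z = z} {v = m₂} I.reads₂ Q h₂ t₂
      blocks-reads : ∀ {a} {v : Vec (Fin (len r)) a} {ws} {q : Pattern a} →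
                     map (lookup z) v ≡ ws → IsOccurrence q λ' ws →
                     ∀ i j → (restrict λ' z ⊢ lookup v i ∼ lookup v j) ≡ (P q ⊢ i ∼ j)
      blocks-reads {v = v} reads o i j =
        trans (restrict-∼ λ' z _ _)
          (trans (cong₂ (λ' ⊢_∼_) (lookup-reads {z = z} {v = v} reads i)
                                  (lookup-reads {z = z} {v = v} reads j))
                 (IsOccurrence.blocks o i j))

    inducedPattern-occurrence : IsOccurrence (inducedPattern r) λ' z
    inducedPattern-occurrence = record
      { isAscending = asc
      ; blocks      = λ i j → sym (restrict-∼ λ' z i j)
      ; firsts      = λ i t → hitBy-either (T ∘ isFirst λ') o₁.firsts o₂.firsts
                                (subst T (lookup∘tabulate _ i) t)
      ; lasts       = λ i t → hitBy-either (T ∘ isLast λ') o₁.lasts o₂.lasts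
                                (subst T (lookup∘tabulate _ i) t)
      ; arcs        = λ i j t → hitBy₂-either (λ u w → T (isArc λ' u w)) o₁.arcs o₂.arcs
                                  (subst T (relOf-∋ _ i j) t)
      ; adjacencies = λ i j t → hitBy₂-either (λ u w → T (adjacent u w))
                                  o₁.adjacencies o₂.adjacencies (subst T (relOf-∋ _ i j) t)
      }

    inducedPattern-merge : IsMerge p₁ p₂ (inducedPattern r) m₁ m₂
    inducedPattern-merge = record
      { isAscending₁ = ascending-map⁻ asc (subst Ascending (sym I.reads₁) o₁.isAscending)
      ; isAscending₂ = ascending-map⁻ asc (subst Ascending (sym I.reads₂) o₂.isAscending)
      ; covers       = I.covering
      ; blocks₁      = blocks-reads I.reads₁ o₁
      ; blocks₂      = blocks-reads I.reads₂ o₂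
      ; firsts       = lookup∘tabulate _
      ; lasts        = lookup∘tabulate _
      ; arcs         = relOf-∋ _
      ; adjacencies  = relOf-∋ _
      }

  fromInterleaving : ∀ {xs ys} (r : Interleaving n k₁ k₂) → Ascending (seq r) →
                     Interleaves r xs ys → IsOccurrence p₁ λ' xs → IsOccurrence p₂ λ' ys →
                     MergeTriples p₁ p₂ λ'
  fromInterleaving r asc I o₁ o₂ =
    len r , inducedPattern r ,
    (seq r , from isOccurrence⇔ (inducedPattern-occurrence asc I o₁ o₂)) ,
    ((pos₁ r , pos₂ r) , from isMerge⇔ (inducedPattern-merge asc I o₁ o₂))

  toMergeTriple : OccPairs p₁ p₂ λ' → MergeTriples p₁ p₂ λ'
  toMergeTriple ((xs , ox) , (ys , oy)) =
    fromInterleaving (interleave xs ys)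
      (interleave-ascending xs ys (IsOccurrence.isAscending o₁) (IsOccurrence.isAscending o₂))
      (interleave-interleaves xs ys) o₁ o₂
    where
    o₁ : IsOccurrence p₁ λ' xs
    o₁ = to isOccurrence⇔ ox
    o₂ : IsOccurrence p₂ λ' ys
    o₂ = to isOccurrence⇔ oy

  toOccPairs : MergeTriples p₁ p₂ λ' → OccPairs p₁ p₂ λ'
  toOccPairs (_ , p₃ , (z , oz) , ((m₁ , m₂) , mg)) =
    (map (lookup z) m₁ , from isOccurrence⇔ (occurrence-along-merge o g)) ,
    (map (lookup z) m₂ , from isOccurrence⇔ (occurrence-along-merge o (swap-merge g)))
    where
    o : IsOccurrence p₃ λ' z
    o = to isOccurrence⇔ oz
    g : IsMerge p₁ p₂ p₃ m₁ m₂
    g = to isMerge⇔ mg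

  occurrence-≡ : ∀ {k} {p : Pattern k} {u v} → u ≡ v →
                 (ou : T (isOccurrence p λ' u)) (ov : T (isOccurrence p λ' v)) →
                 _≡_ {A = Occurrence p λ'} (u , ou) (v , ov)
  occurrence-≡ refl ou ov = cong (_ ,_) (T-irrelevant ou ov)

  toOccPairs∘toMergeTriple : ∀ x → toOccPairs (toMergeTriple x) ≡ x
  toOccPairs∘toMergeTriple ((xs , ox) , (ys , oy)) =
    cong₂ _,_ (occurrence-≡ {p = p₁} (Interleaves.reads₁ I) _ ox)
              (occurrence-≡ {p = p₂} (Interleaves.reads₂ I) _ oy)
    where I = interleave-interleaves xs ys

  inducedPattern-≡ : ∀ {k} {p₃ : Pattern k} {z m₁ m₂} →
                     IsOccurrence p₃ λ' z → IsMerge p₁ p₂ p₃ m₁ m₂ →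
                     inducedPattern (interleaving k z m₁ m₂) ≡ p₃
  inducedPattern-≡ {z = z} o g = pattern-≡
    (Rel-ext λ i j → trans (restrict-∼ λ' z i j) (IsOccurrence.blocks o i j))
    (Sub-ext λ i → trans (lookup∘tabulate _ i) (sym (IsMerge.firsts g i)))
    (Sub-ext λ i → trans (lookup∘tabulate _ i) (sym (IsMerge.lasts g i)))
    (Rel-ext λ i j → trans (relOf-∋ _ i j) (sym (IsMerge.arcs g i j)))
    (Rel-ext λ i j → trans (relOf-∋ _ i j) (sym (IsMerge.adjacencies g i j)))

  fromInterleaving-≡ : ∀ {k} {p₃ : Pattern k} {z m₁ m₂ xs ys} {r : Interleaving n k₁ k₂} →
                       r ≡ interleaving k z m₁ m₂ → inducedPattern (interleaving k z m₁ m₂) ≡ p₃ →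
                       ∀ asc (I : Interleaves r xs ys) o₁ o₂ oz mg →
                       fromInterleaving r asc I o₁ o₂ ≡ (k , p₃ , (z , oz) , ((m₁ , m₂) , mg))
  fromInterleaving-≡ refl refl asc I o₁ o₂ oz mg =
    cong₂ (λ oz mg → _ , _ , (_ , oz) , (_ , mg)) (T-irrelevant _ oz) (T-irrelevant _ mg)

  toMergeTriple∘toOccPairs : ∀ t → toMergeTriple (toOccPairs t) ≡ t
  toMergeTriple∘toOccPairs (_ , p₃ , (z , oz) , ((m₁ , m₂) , mg)) =
    fromInterleaving-≡ (interleave-unique o.isAscending g.isAscending₁ g.isAscending₂ g.covers)
                       (inducedPattern-≡ o g) _ _ _ _ oz mg
    where
    o : IsOccurrence p₃ λ' z
    o = to isOccurrence⇔ oz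
    g : IsMerge p₁ p₂ p₃ m₁ m₂
    g = to isMerge⇔ mg
    module o = IsOccurrence o
    module g = IsMerge g

  toMergeTriple-reads : ∀ s₁ s₂ {k₃} {p₃ : Pattern k₃} (s₃ : Occurrence p₃ λ')
                        (mm : Merge p₁ p₂ p₃) →
                        toMergeTriple (s₁ , s₂) ≡ (k₃ , p₃ , s₃ , mm) →
                        proj₁ s₁ ≡ map (lookup (proj₁ s₃)) (proj₁ (proj₁ mm)) ×
                        proj₁ s₂ ≡ map (lookup (proj₁ s₃)) (proj₂ (proj₁ mm))
  toMergeTriple-reads s₁ s₂ _ _ eq = cong (proj₁ ∘ proj₁) pairs , cong (proj₁ ∘ proj₂) pairs
    where pairs = trans (sym (toOccPairs∘toMergeTriple (s₁ , s₂))) (cong toOccPairs eq)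

eval-cong : ∀ {k} (Q : Poly k) {f g : Fin k → ℤ} → (∀ i → f i ≡ g i) → ∀ v → eval Q f v ≡ eval Q g v
eval-cong (y i)   f≡g v = f≡g i
eval-cong m       f≡g v = refl
eval-cong (con c) f≡g v = refl
eval-cong (Q ⊕ R) f≡g v = cong₂ _+_ (eval-cong Q f≡g v) (eval-cong R f≡g v)
eval-cong (Q ⊗ R) f≡g v = cong₂ _*_ (eval-cong Q f≡g v) (eval-cong R f≡g v)

evalVia-reads : ∀ {k k₃ n} (Q : Poly k) (z : Vec (Fin n) k₃) (v : Vec (Fin k₃) k) {xs} →
                xs ≡ map (lookup z) v → evalVia Q z v ≡ evalAt Q xs
evalVia-reads Q z v refl = eval-cong Q (λ i → cong val (sym (lookup-map i (lookup z) v))) _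

lemma6p4 : ∀ {k₁ k₂ n : ℕ} (p₁ : Pattern k₁) (p₂ : Pattern k₂)
             (Q₁ : Poly k₁) (Q₂ : Poly k₂) (λ' : SetPartition n) →
           Σ (OccPairs p₁ p₂ λ' ⤖ MergeTriples p₁ p₂ λ') (λ f →
             ∀ (s₁ : Occurrence p₁ λ') (s₂ : Occurrence p₂ λ')
               (k₃ : ℕ) (p₃ : Pattern k₃) (s₃ : Occurrence p₃ λ') (mm : Merge p₁ p₂ p₃) →
             Bijection.to f (s₁ , s₂) ≡ (k₃ , p₃ , s₃ , mm) →
             evalVia Q₁ (proj₁ s₃) (proj₁ (proj₁ mm)) * evalVia Q₂ (proj₁ s₃) (proj₂ (proj₁ mm))
               ≡ evalAt Q₁ (proj₁ s₁) * evalAt Q₂ (proj₁ s₂))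
lemma6p4 p₁ p₂ Q₁ Q₂ λ' =
  ↔⇒⤖ (mk↔ₛ′ toMergeTriple toOccPairs toMergeTriple∘toOccPairs toOccPairs∘toMergeTriple) ,
  λ s₁ s₂ k₃ p₃ s₃@(z , _) mm@((m₁ , m₂) , _) eq →
    let reads₁ , reads₂ = toMergeTriple-reads s₁ s₂ s₃ mm eq
    in cong₂ _*_ (evalVia-reads Q₁ z m₁ reads₁) (evalVia-reads Q₂ z m₂ reads₂)
  where open Correspondence p₁ p₂ λ'
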